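{- Let $G$ be a connected graph with terminal set $Z\subseteq V(G)$. Then $G$ has no terminal-$K_{2,3}$ minor if and only if for every block ($2$-connected component) $B$ of $G$, the graph obtained from $G$ by contracting every edge not in $B$ has no terminal-$K_{2,3}$ minor.
   Context: A graph $H$ is a terminal minor ($Z$-minor) of $G$ if it is a minor of $G$ in which each vertex of $H$ arises by contracting a connected subgraph of $G$ containing a vertex of $Z$; a terminal-$K_{2,3}$ minor is a $Z$-minor isomorphic to $K_{2,3}$. When edges are contracted, a vertex of the resulting graph is a terminal if the set of original vertices contracted into it contains a vertex of $Z$. -}

module Defs where

open import Data.Nat using (ℕ)
open import Data.Fin using (Fin; zero; suc)
open import Data.Fin.Subset using (Subset; _∈_; _∉_; _⊆_; _-_; Nonempty)
  renaming (⊤ to Full)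
open import Data.Bool using (Bool; true; false)
open import Data.Product using (Σ; ∃; ∃₂; _×_; _,_)
open import Function.Bundles using (_⇔_)
open import Relation.Nullary using (¬_; Dec)
open import Relation.Binary.PropositionalEquality using (_≡_; _≢_; refl; ≢-sym)

record Graph : Set₁ where
  field
    n      : ℕ
    Adj    : Fin n → Fin n → Set
    adj?   : ∀ u v → Dec (Adj u v)
    sym    : ∀ {u v} → Adj u v → Adj v u
    irrefl : ∀ {u} → ¬ Adj u u
open Graph public

module _ (G : Graph) where

  data WalkIn (X : Subset (n G)) : Fin (n G) → Fin (n G) → Set where
    here : ∀ {u} → u ∈ X → WalkIn X u u
    step : ∀ {u w v} → u ∈ X → Adj G u w → WalkIn X w v → WalkIn X u v

  ConnectedSet : Subset (n G) → Set
  ConnectedSet X = ∀ u v → u ∈ X → v ∈ X → WalkIn X u v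

  Connected : Set
  Connected = ConnectedSet Full

  NoCutVertex : Subset (n G) → Set
  NoCutVertex X = ∀ x → x ∈ X → ConnectedSet (X - x)

  -- X is (the vertex set of) a block of G: a maximal connected subgraph
  -- without a cut vertex (maximal such subgraphs are induced, so a block is
  -- the induced subgraph G[X]).
  IsBlock : Subset (n G) → Set
  IsBlock X = Nonempty X × ConnectedSet X × NoCutVertex X
            × (∀ Y → X ⊆ Y → ConnectedSet Y → NoCutVertex Y → Y ⊆ X)

  EdgeNotIn : Subset (n G) → Fin (n G) → Fin (n G) → Set
  EdgeNotIn X u v = Adj G u v × ¬ (u ∈ X × v ∈ X)

  data FWalk (F : Fin (n G) → Fin (n G) → Set) : Fin (n G) → Fin (n G) → Set where
    done : ∀ {u} → FWalk F u u
    step : ∀ {u w v} → F u w → FWalk F w v → FWalk F u v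

-- H (with terminal set Z') is the graph obtained from G (with terminal set Z)
-- by contracting every edge in the edge set F (F ⊆ E(G)). Resulting loops are
-- deleted and parallel edges identified (irrelevant for minors).
record IsContraction (G : Graph) (Z : Subset (n G))
                     (F : Fin (n G) → Fin (n G) → Set)
                     (H : Graph) (Z' : Subset (n H))
                     (π : Fin (n G) → Fin (n H)) : Set where
  field
    surj  : ∀ a → ∃ λ u → π u ≡ a
    merge : ∀ u v → (π u ≡ π v) ⇔ FWalk G F u v
    adj   : ∀ a b → Adj H a b ⇔
              (a ≢ b × ∃₂ λ u v → π u ≡ a × π v ≡ b × Adj G u v × ¬ F u v)
    term  : ∀ a → a ∈ Z' ⇔ (∃ λ u → π u ≡ a × u ∈ Z)

record ZMinor (H G : Graph) (Z : Subset (n G)) : Set where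
  field
    branch    : Fin (n H) → Subset (n G)
    disjoint  : ∀ h h' v → v ∈ branch h → v ∈ branch h' → h ≡ h'
    connected : ∀ h → ConnectedSet G (branch h)
    terminal  : ∀ h → ∃ λ z → z ∈ Z × z ∈ branch h
    edges     : ∀ h h' → Adj H h h' →
                  ∃₂ λ u v → u ∈ branch h × v ∈ branch h' × Adj G u v

side : Fin 5 → Bool
side zero = true
side (suc zero) = true
side _ = false

K23 : Graph
K23 = record
  { n      = 5
  ; Adj    = λ i j → side i ≢ side j
  ; adj?   = λ i j → Relation.Nullary.¬? (side i Data.Bool.≟ side j)
  ; sym    = ≢-sym
  ; irrefl = λ p → p refl
  }
  where import Data.Bool

HasTerminalK23 : (G : Graph) → Subset (n G) → Set
HasTerminalK23 G Z = ZMinor K23 G Z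

module Submission where

-- Terminal K₂,₃ minors live in a single block.
--
-- (⇒) Contracting edges never creates a Z-minor: if H is obtained from G by
--     contracting an edge set F ⊆ E(G), the preimages under the contraction
--     map of the branch sets of a Z'-minor of H are branch sets of a Z-minor
--     of G (liftMinor, for an arbitrary minor graph K).
-- (⇐) Let X₀,…,X₄ be the branch sets of a terminal K₂,₃ minor of G. An edge
--     between X₀ and X₂ lies in some block B (blockThroughEdge). For every
--     other branch set there is a simple path between the ends of that edge
--     which runs through it (chainPath); a simple path joining two vertices
--     of a block stays in the block (pathInBlock, the ear argument), so B meets
--     all five branch sets. Contracting the edges outside B sends every vertex
--     to its unique attachment vertex in B (BlockContraction); since each
--     branch set is connected and meets B, it contains the attachments of its
--     vertices, so the images of the branch sets stay disjoint and form a
--     terminal K₂,₃ minor of the contraction (pushMinor).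

open import Defs hiding (sym)
open import Data.Nat using (ℕ; zero; suc; _+_; _≤_; _<_)
open import Data.Nat.Properties
  using (+-suc; +-monoʳ-≤; <-irrefl; ≤-<-trans; <-≤-trans; m≤m+n; module ≤-Reasoning)
open import Data.Fin using (Fin; zero; suc; _≟_)
open import Data.Fin.Properties using (any?)
open import Data.Fin.Subset using (Subset; _∈_; _∉_; _⊆_; _-_; _─_; Nonempty; ⁅_⁆; ∣_∣; inside; outside)
open import Data.Fin.Subset.Properties
  using (x∈p∧x≢y⇒x∈p-y; p─q⊆p; x∉⁅y⁆⇒x≢y; p⊂q⇒∣p∣<∣q∣; ∣p∣≤n; ∈⊤; _∈?_)
open import Data.Vec using (_∷_; tabulate; _[_]=_)
open import Data.Vec.Properties using (lookup∘tabulate; []=⇒lookup; lookup⇒[]=)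
open import Data.Product using (Σ; ∃; ∃₂; _×_; _,_; proj₁; proj₂; map₁)
open import Data.Sum using (_⊎_; inj₁; inj₂; [_,_]′)
open import Data.Empty using (⊥; ⊥-elim)
open import Data.Unit using (⊤; tt)
open import Data.List using (List; []; _∷_; _++_; [_]; filter; allFin; length; lookup)
open import Data.List.Relation.Unary.Any using (here; there; index)
open import Data.List.Relation.Unary.Any.Properties using (lookup-index)
open import Data.List.Relation.Unary.All as All using (All; []; _∷_)
open import Data.List.Relation.Unary.All.Properties using (¬Any⇒All¬)
open import Data.List.Relation.Unary.AllPairs using ([]; _∷_)
open import Data.List.Relation.Unary.Unique.Propositional using (Unique)
import Data.List.Relation.Unary.Unique.Propositional.Properties as Unique
open import Data.List.Relation.Binary.Disjoint.Propositional using (Disjoint)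
open import Data.List.Membership.Propositional using () renaming (_∈_ to _∈ˡ_)
open import Data.List.Membership.Propositional.Properties
  using (∈-++⁺ˡ; ∈-++⁺ʳ; ∈-++⁻; ∈-filter⁺; ∈-filter⁻; ∈-allFin; ∈-lookup)
import Data.List.Membership.DecPropositional as DecMembership
open import Function using (_∘_)
open import Function.Bundles using (_⇔_; mk⇔; Equivalence)
open import Relation.Nullary using (¬_; Dec; yes; no; does; ¬?)
open import Relation.Nullary.Decidable using (dec-true; _⊎-dec_; _×-dec_; ¬¬-excluded-middle)
open import Relation.Binary.PropositionalEquality using (_≡_; _≢_; refl; sym; trans; cong; subst)

open Equivalence using (to; from)

⟦_⟧ : ∀ {n} {P : Fin n → Set} → (∀ x → Dec (P x)) → Subset n
⟦ P? ⟧ = tabulate (λ x → does (P? x))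

∈⟦⟧⁺ : ∀ {n} {P : Fin n → Set} (P? : ∀ x → Dec (P x)) {x} → P x → x ∈ ⟦ P? ⟧
∈⟦⟧⁺ P? {x} px =
  lookup⇒[]= x _ (trans (lookup∘tabulate _ x) (dec-true (P? x) px))

∈⟦⟧⁻ : ∀ {n} {P : Fin n → Set} (P? : ∀ x → Dec (P x)) {x} → x ∈ ⟦ P? ⟧ → P x
∈⟦⟧⁻ P? {x} x∈ with P? x | trans (sym (lookup∘tabulate _ x)) ([]=⇒lookup x∈)
... | yes px | _ = px
... | no _   | ()

∈─⇒∉ : ∀ {n} (p q : Subset n) (y : Fin n) → y ∈ p ─ q → y ∉ q
∈─⇒∉ (_ ∷ p) (outside ∷ q) zero _ ()
∈─⇒∉ (_ ∷ p) (inside ∷ q) zero () _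
∈─⇒∉ (_ ∷ p) (_ ∷ q) (suc y) (_[_]=_.there y∈) (_[_]=_.there y∈q) = ∈─⇒∉ p q y y∈ y∈q

∈-⁻ : ∀ {n} {p : Subset n} {x y : Fin n} → y ∈ p - x → y ∈ p × y ≢ x
∈-⁻ {p = p} {x} {y} y∈ = p─q⊆p p ⁅ x ⁆ y∈ , x∉⁅y⁆⇒x≢y (∈─⇒∉ p ⁅ x ⁆ y y∈)

∈-⁺ : ∀ {n} {p : Subset n} {x y : Fin n} → y ∈ p → y ≢ x → y ∈ p - x
∈-⁺ = x∈p∧x≢y⇒x∈p-y

module Walks (G : Graph) where

  V : Set
  V = Fin (n G)

  data Walk (E : V → V → Set) (P : V → Set) : V → V → Set where
    nil  : ∀ {u} → P u → Walk E P u u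
    cons : ∀ {u w v} → P u → E u w → Walk E P w v → Walk E P u v

  module _ {E : V → V → Set} {P : V → Set} where

    first : ∀ {u v} → Walk E P u v → P u
    first (nil pu)      = pu
    first (cons pu _ _) = pu

    last : ∀ {u v} → Walk E P u v → P v
    last (nil pv)     = pv
    last (cons _ _ w) = last w

    _++ʷ_ : ∀ {u v w} → Walk E P u v → Walk E P v w → Walk E P u w
    nil _       ++ʷ w' = w'
    cons pu e w ++ʷ w' = cons pu e (w ++ʷ w')

    reverse : (∀ {a b} → E a b → E b a) → ∀ {u v} → Walk E P u v → Walk E P v u
    reverse E-sym (nil pu)      = nil pu
    reverse E-sym (cons pu e w) = reverse E-sym w ++ʷ cons (first w) (E-sym e) (nil pu)

  weaken : ∀ {E P Q} → (∀ {a} → P a → Q a) → ∀ {u v} → Walk E P u v → Walk E Q u v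
  weaken f (nil pu)      = nil (f pu)
  weaken f (cons pu e w) = cons (f pu) e (weaken f w)

  toWalkIn : ∀ {P} {X : Subset (n G)} → (∀ {a} → P a → a ∈ X) →
             ∀ {u v} → Walk (Adj G) P u v → WalkIn G X u v
  toWalkIn f (nil pu)      = here (f pu)
  toWalkIn f (cons pu e w) = step (f pu) e (toWalkIn f w)

  fromWalkIn : ∀ {X : Subset (n G)} {u v} → WalkIn G X u v → Walk (Adj G) (_∈ X) u v
  fromWalkIn (here u∈)     = nil u∈
  fromWalkIn (step u∈ e w) = cons u∈ e (fromWalkIn w)

  data Path (E : V → V → Set) : V → V → List V → Set where
    single : ∀ {x} → Path E x x [ x ]
    _∷ᵖ_   : ∀ {x w y vs} → E x w → Path E w y vs → Path E x y (x ∷ vs)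

  pathFirst : ∀ {E x y vs} → Path E x y vs → x ∈ˡ vs
  pathFirst single   = here refl
  pathFirst (_ ∷ᵖ _) = here refl

  pathLast : ∀ {E x y vs} → Path E x y vs → y ∈ˡ vs
  pathLast single   = here refl
  pathLast (_ ∷ᵖ p) = there (pathLast p)

  mapᵖ : ∀ {E E'} → (∀ {a b} → E a b → E' a b) → ∀ {x y vs} → Path E x y vs → Path E' x y vs
  mapᵖ f single   = single
  mapᵖ f (e ∷ᵖ p) = f e ∷ᵖ mapᵖ f p

  join : ∀ {E x y y' z vs ws} → Path E x y vs → E y y' → Path E y' z ws → Path E x z (vs ++ ws)
  join single    e q = e ∷ᵖ q
  join (e' ∷ᵖ p) e q = e' ∷ᵖ join p e q

  SimplePath : (E : V → V → Set) (P : V → Set) → V → V → Set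
  SimplePath E P u v = Σ (List V) λ vs → Path E u v vs × Unique vs × All P vs

  suffixFrom : ∀ {E P u w v vs} → Path E w v vs → Unique vs → All P vs → u ∈ˡ vs → SimplePath E P u v
  suffixFrom single   uniq all (here refl) = _ , single , uniq , all
  suffixFrom (e ∷ᵖ p) uniq all (here refl) = _ , e ∷ᵖ p , uniq , all
  suffixFrom (_ ∷ᵖ p) (_ ∷ uniq) (_ ∷ all) (there u∈) = suffixFrom p uniq all u∈

  open DecMembership (_≟_ {n G}) using () renaming (_∈?_ to _∈ˡ?_)

  shortcut : ∀ {E P u v} → Walk E P u v → SimplePath E P u v
  shortcut (nil pu) = _ , single , ([] ∷ []) , (pu ∷ [])
  shortcut {u = u} (cons pu e w) with shortcut w
  ... | vs , p , uniq , all with u ∈ˡ? vs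
  ...   | yes u∈ = suffixFrom p uniq all u∈
  ...   | no u∉  = u ∷ vs , e ∷ᵖ p , (¬Any⇒All¬ vs u∉ ∷ uniq) , (pu ∷ all)

module Blocks (G : Graph) where
  open Walks G
  open DecMembership (_≟_ {n G}) using () renaming (_∈?_ to _∈ˡ?_)

  toEnd : ∀ {E x y vs p} → Path E x y vs → p ∈ˡ vs → Walk E (_∈ˡ vs) p y
  toEnd single   (here refl) = nil (here refl)
  toEnd (e ∷ᵖ q) (here refl) = cons (here refl) e (weaken there (toEnd q (pathFirst q)))
  toEnd (_ ∷ᵖ q) (there p∈)  = weaken there (toEnd q p∈)

  Avoiding : List V → V → V → Set
  Avoiding vs z u = u ∈ˡ vs × u ≢ z

  -- A vertex p ≢ z of a simple path can walk along the path, avoiding z, to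
  -- one of its two ends: z can block at most one of the two directions.
  escape : ∀ {x y vs z p} → Path (Adj G) x y vs → Unique vs → p ∈ˡ vs → p ≢ z →
           Walk (Adj G) (Avoiding vs z) p x ⊎ Walk (Adj G) (Avoiding vs z) p y
  escape single   _ (here refl) p≢z = inj₁ (nil (here refl , p≢z))
  escape (_ ∷ᵖ _) _ (here refl) p≢z = inj₁ (nil (here refl , p≢z))
  escape {x = x} {z = z} (e ∷ᵖ q) (x∉q ∷ uniq) (there p∈) p≢z with escape q uniq p∈ p≢z
  ... | inj₂ w = inj₂ (weaken (map₁ there) w)
  ... | inj₁ w with x ≟ z
  ...   | no x≢z   = inj₁ (weaken (map₁ there) w ++ʷ
                             cons (there (pathFirst q) , proj₂ (last w)) (Graph.sym G e) (nil (here refl , x≢z)))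
  ...   | yes refl = inj₂ (weaken (λ a∈q → there a∈q , λ a≡x → All.lookup x∉q a∈q (sym a≡x))
                                (toEnd q p∈))

  connectedThrough : ∀ {R K : V → Set} →
    (∀ k k' → K k → K k' → Walk (Adj G) R k k') →
    (∀ u → R u → Σ V λ k → K k × Walk (Adj G) R u k) →
    ∀ u v → R u → R v → Walk (Adj G) R u v
  connectedThrough core reach u v ru rv with reach u ru | reach v rv
  ... | k , kK , wu | k' , k'K , wv = wu ++ʷ (core k k' kK k'K ++ʷ reverse (Graph.sym G) wv)

  -- Ear lemma: adding to a 2-connected set B a simple path with both ends
  -- in B yields a 2-connected set.
  module Ear {B : Subset (n G)} (cB : ConnectedSet G B) (ncB : NoCutVertex G B)
             {x y vs} (path : Path (Adj G) x y vs) (uniq : Unique vs) (x∈B : x ∈ B) (y∈B : y ∈ B) where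

    ear? : ∀ u → Dec (u ∈ B ⊎ u ∈ˡ vs)
    ear? u = (u ∈? B) ⊎-dec (u ∈ˡ? vs)

    ear : Subset (n G)
    ear = ⟦ ear? ⟧

    earConnected : ConnectedSet G ear
    earConnected u v u∈ v∈ = toWalkIn (λ a → a) (connectedThrough core reach u v u∈ v∈)
      where
      core : ∀ k k' → k ∈ B → k' ∈ B → Walk (Adj G) (_∈ ear) k k'
      core k k' k∈ k'∈ = weaken (∈⟦⟧⁺ ear? ∘ inj₁) (fromWalkIn (cB k k' k∈ k'∈))
      reach : ∀ u → u ∈ ear → Σ V λ k → k ∈ B × Walk (Adj G) (_∈ ear) u k
      reach u u∈ with ∈⟦⟧⁻ ear? u∈
      ... | inj₁ u∈B  = u , u∈B , nil u∈
      ... | inj₂ u∈vs = y , y∈B , weaken (∈⟦⟧⁺ ear? ∘ inj₂) (toEnd path u∈vs)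

    earNoCutVertex : NoCutVertex G ear
    earNoCutVertex z _ u v u∈ v∈ = toWalkIn (λ a → a) (connectedThrough core reach u v u∈ v∈)
      where
      R : V → Set
      R a = a ∈ ear - z
      K : V → Set
      K a = a ∈ B × a ≢ z
      inR : ∀ {a} → a ∈ B ⊎ a ∈ˡ vs → a ≢ z → R a
      inR a∈ a≢z = ∈-⁺ (∈⟦⟧⁺ ear? a∈) a≢z
      core : ∀ k k' → K k → K k' → Walk (Adj G) R k k'
      core k k' (k∈ , k≢z) (k'∈ , k'≢z) with z ∈? B
      ... | yes z∈B = weaken (λ a∈ → let (a∈B , a≢z) = ∈-⁻ a∈ in inR (inj₁ a∈B) a≢z)
                        (fromWalkIn (ncB z z∈B k k' (∈-⁺ k∈ k≢z) (∈-⁺ k'∈ k'≢z)))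
      ... | no z∉B  = weaken (λ a∈B → inR (inj₁ a∈B) (λ { refl → z∉B a∈B }))
                        (fromWalkIn (cB k k' k∈ k'∈))
      reach : ∀ u → R u → Σ V λ k → K k × Walk (Adj G) R u k
      reach u u∈R with ∈-⁻ u∈R
      ... | u∈ , u≢z with ∈⟦⟧⁻ ear? u∈
      ...   | inj₁ u∈B  = u , (u∈B , u≢z) , nil u∈R
      ...   | inj₂ u∈vs with escape path uniq u∈vs u≢z
      ...     | inj₁ w = x , (x∈B , proj₂ (last w)) , weaken (λ (a∈ , a≢z) → inR (inj₂ a∈) a≢z) w
      ...     | inj₂ w = y , (y∈B , proj₂ (last w)) , weaken (λ (a∈ , a≢z) → inR (inj₂ a∈) a≢z) w

  -- A simple path joining two vertices of a block lies inside the block,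
  -- since otherwise the block plus the path would be a larger 2-connected set.
  pathInBlock : ∀ {B} → IsBlock G B → ∀ {x y vs} → Path (Adj G) x y vs → Unique vs →
                x ∈ B → y ∈ B → ∀ {u} → u ∈ˡ vs → u ∈ B
  pathInBlock (_ , cB , ncB , maximal) path uniq x∈B y∈B u∈ =
    maximal ear (∈⟦⟧⁺ ear? ∘ inj₁) earConnected earNoCutVertex (∈⟦⟧⁺ ear? (inj₂ u∈))
    where open Ear cB ncB path uniq x∈B y∈B

  Enlargeable : Subset (n G) → Set
  Enlargeable S = Σ (Subset (n G)) λ Y →
    S ⊆ Y × ConnectedSet G Y × NoCutVertex G Y × ∃ λ x → x ∈ Y × x ∉ S

  unenlargeable⇒block : ∀ {S} → Nonempty S → ConnectedSet G S → NoCutVertex G S →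
                        ¬ Enlargeable S → IsBlock G S
  unenlargeable⇒block {S} ne cS ncS noExt = ne , cS , ncS , maximal
    where
    maximal : ∀ Y → S ⊆ Y → ConnectedSet G Y → NoCutVertex G Y → Y ⊆ S
    maximal Y S⊆Y cY ncY {x} x∈Y with x ∈? S
    ... | yes x∈S = x∈S
    ... | no x∉S  = ⊥-elim (noExt (Y , S⊆Y , cY , ncY , x , x∈Y , x∉S))

  BlockAbove : Subset (n G) → Set
  BlockAbove S = Σ (Subset (n G)) λ B → S ⊆ B × IsBlock G B

  -- Every nonempty 2-connected set lies in a block: enlarge it as long as
  -- possible (a classical choice, hence the double negation). The fuel k
  -- bounds the number of enlargements, since each one increases ∣ S ∣.
  blockAbove′ : ∀ k S → n G ≤ k + ∣ S ∣ → Nonempty S → ConnectedSet G S → NoCutVertex G S →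
                ¬ ¬ BlockAbove S
  blockAbove′ k S bound ne cS ncS noBlock = ¬¬-excluded-middle decide
    where
    decide : Dec (Enlargeable S) → ⊥
    decide (no noExt) = noBlock (S , (λ a → a) , unenlargeable⇒block ne cS ncS noExt)
    decide (yes (Y , S⊆Y , cY , ncY , x , x∈Y , x∉S)) = grow k bound
      where
      S<Y : ∣ S ∣ < ∣ Y ∣
      S<Y = p⊂q⇒∣p∣<∣q∣ (S⊆Y , x , x∈Y , x∉S)
      grow : ∀ j → n G ≤ j + ∣ S ∣ → ⊥
      grow zero    bound′ = <-irrefl refl (≤-<-trans bound′ (<-≤-trans S<Y (∣p∣≤n Y)))
      grow (suc j) bound′ =
        blockAbove′ j Y bound″ (x , x∈Y) cY ncY λ (B , Y⊆B , isB) → noBlock (B , Y⊆B ∘ S⊆Y , isB)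
        where
        open ≤-Reasoning
        bound″ : n G ≤ j + ∣ Y ∣
        bound″ = begin
          n G           ≤⟨ bound′ ⟩
          suc j + ∣ S ∣ ≡⟨ sym (+-suc j ∣ S ∣) ⟩
          j + suc ∣ S ∣ ≤⟨ +-monoʳ-≤ j S<Y ⟩
          j + ∣ Y ∣     ∎

  blockAbove : ∀ S → Nonempty S → ConnectedSet G S → NoCutVertex G S → ¬ ¬ BlockAbove S
  blockAbove S = blockAbove′ (n G) S (m≤m+n (n G) ∣ S ∣)

  edgeSet : ∀ {u v} → Adj G u v → Σ (Subset (n G)) λ S →
            u ∈ S × v ∈ S × ConnectedSet G S × NoCutVertex G S
  edgeSet {u} {v} e = S , ∈⟦⟧⁺ ends? (inj₁ refl) , ∈⟦⟧⁺ ends? (inj₂ refl) , connected , noCut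
    where
    ends? : ∀ a → Dec (a ≡ u ⊎ a ≡ v)
    ends? a = (a ≟ u) ⊎-dec (a ≟ v)
    S : Subset (n G)
    S = ⟦ ends? ⟧
    joined : ∀ {X : Subset (n G)} {a b} → a ∈ X → b ∈ X →
             a ≡ u ⊎ a ≡ v → b ≡ u ⊎ b ≡ v → WalkIn G X a b
    joined a∈ b∈ (inj₁ refl) (inj₁ refl) = here a∈
    joined a∈ b∈ (inj₁ refl) (inj₂ refl) = step a∈ e (here b∈)
    joined a∈ b∈ (inj₂ refl) (inj₁ refl) = step a∈ (Graph.sym G e) (here b∈)
    joined a∈ b∈ (inj₂ refl) (inj₂ refl) = here a∈
    connected : ConnectedSet G S
    connected a b a∈ b∈ = joined a∈ b∈ (∈⟦⟧⁻ ends? a∈) (∈⟦⟧⁻ ends? b∈)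
    noCut : NoCutVertex G S
    noCut z _ a b a∈ b∈ =
      joined a∈ b∈ (∈⟦⟧⁻ ends? (proj₁ (∈-⁻ a∈))) (∈⟦⟧⁻ ends? (proj₁ (∈-⁻ b∈)))

  blockThroughEdge : ∀ {u v} → Adj G u v → ¬ ¬ (Σ (Subset (n G)) λ B → IsBlock G B × u ∈ B × v ∈ B)
  blockThroughEdge e noBlock with edgeSet e
  ... | S , u∈S , v∈S , cS , ncS =
    blockAbove S (_ , u∈S) cS ncS λ (B , S⊆B , isB) → noBlock (B , isB , S⊆B u∈S , S⊆B v∈S)

lookup-injective : ∀ {A : Set} {xs : List A} → Unique xs → ∀ i j → lookup xs i ≡ lookup xs j → i ≡ j
lookup-injective (_ ∷ _)   zero    zero    _  = refl
lookup-injective (x∉ ∷ _)  zero    (suc j) eq = ⊥-elim (All.lookup x∉ (∈-lookup j) eq)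
lookup-injective (x∉ ∷ _)  (suc i) zero    eq = ⊥-elim (All.lookup x∉ (∈-lookup i) (sym eq))
lookup-injective (_ ∷ uniq) (suc i) (suc j) eq = cong suc (lookup-injective uniq i j eq)

-- The image of an idempotent map r on Fin N, presented as Fin M: the map π
-- sending u to the position of r u among the fixed points of r is surjective
-- and identifies exactly the points with equal r-values.
module Image {N : ℕ} (r : Fin N → Fin N) (idem : ∀ x → r (r x) ≡ r x) where

  fixed? : ∀ x → Dec (r x ≡ x)
  fixed? x = r x ≟ x

  fixedPoints : List (Fin N)
  fixedPoints = filter fixed? (allFin N)

  fixedPoints-unique : Unique fixedPoints
  fixedPoints-unique = Unique.filter⁺ fixed? (Unique.allFin⁺ N)

  M : ℕ
  M = length fixedPoints

  r∈fixedPoints : ∀ x → r x ∈ˡ fixedPoints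
  r∈fixedPoints x = ∈-filter⁺ fixed? (∈-allFin (r x)) (idem x)

  π : Fin N → Fin M
  π u = index (r∈fixedPoints u)

  lookup-π : ∀ u → lookup fixedPoints (π u) ≡ r u
  lookup-π u = sym (lookup-index (r∈fixedPoints u))

  π-surjective : ∀ a → ∃ λ u → π u ≡ a
  π-surjective a = u , lookup-injective fixedPoints-unique (π u) a (trans (lookup-π u) ru≡u)
    where
    u = lookup fixedPoints a
    ru≡u : r u ≡ u
    ru≡u = proj₂ (∈-filter⁻ fixed? {xs = allFin N} (∈-lookup a))

  π≡⇔r≡ : ∀ u v → π u ≡ π v ⇔ r u ≡ r v
  π≡⇔r≡ u v = mk⇔
    (λ eq → trans (sym (lookup-π u)) (trans (cong (lookup fixedPoints) eq) (lookup-π v)))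
    (λ eq → lookup-injective fixedPoints-unique (π u) (π v) (trans (lookup-π u) (trans eq (sym (lookup-π v)))))

-- Every vertex is joined to B by a walk outside B, and it is joined in this
-- way to exactly one vertex of B, its attachment; two vertices merge iff
-- their attachments agree, so the contraction has one vertex per vertex of B.
module BlockContraction (G : Graph) (Z : Subset (n G)) {B : Subset (n G)}
                        (isBlock : IsBlock G B) (connG : Connected G) where
  open Walks G
  open Blocks G

  Outside : V → V → Set
  Outside = EdgeNotIn G B

  outside? : ∀ u v → Dec (Outside u v)
  outside? u v = adj? G u v ×-dec ¬? ((u ∈? B) ×-dec (v ∈? B))

  outside-sym : ∀ {u v} → Outside u v → Outside v u
  outside-sym (e , ¬both) = Graph.sym G e , λ (v∈ , u∈) → ¬both (u∈ , v∈)

  OutWalk : V → V → Set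
  OutWalk = FWalk G Outside

  _++ᵒ_ : ∀ {u v w} → OutWalk u v → OutWalk v w → OutWalk u w
  done     ++ᵒ w' = w'
  step e w ++ᵒ w' = step e (w ++ᵒ w')

  reverseᵒ : ∀ {u v} → OutWalk u v → OutWalk v u
  reverseᵒ done       = done
  reverseᵒ (step e w) = reverseᵒ w ++ᵒ step (outside-sym e) done

  asWalk : ∀ {u v} → OutWalk u v → Walk Outside (λ _ → ⊤) u v
  asWalk done       = nil tt
  asWalk (step e w) = cons tt e (asWalk w)

  -- Distinct vertices of B are never joined by a walk outside B: the first
  -- edge of its shortening to a simple path leaves B, yet that path lies in
  -- B by pathInBlock.
  separated : ∀ {c c'} → c ∈ B → c' ∈ B → OutWalk c c' → c ≡ c'
  separated c∈ c'∈ w with shortcut (asWalk w)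
  ... | _ , single , _ = refl
  ... | _ , e ∷ᵖ p , uniq , _ =
    ⊥-elim (proj₂ e (c∈ , pathInBlock isBlock (mapᵖ proj₁ (e ∷ᵖ p)) uniq c∈ c'∈ (there (pathFirst p))))

  firstInB : ∀ {P v b} → Walk (Adj G) P v b → b ∈ B → Σ V λ c → c ∈ B × P c × OutWalk v c
  firstInB {v = v} (nil pv) b∈ = v , b∈ , pv , done
  firstInB {v = v} (cons pv e w) b∈ with v ∈? B
  ... | yes v∈ = v , v∈ , pv , done
  ... | no v∉ with firstInB w b∈
  ...   | c , c∈ , pc , w' = c , c∈ , pc , step (e , λ (v∈ , _) → v∉ v∈) w'

  attachment : ∀ v → Σ V λ c → c ∈ B × OutWalk v c
  attachment v with proj₁ isBlock
  ... | b , b∈ with firstInB (fromWalkIn (connG v b ∈⊤ ∈⊤)) b∈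
  ...   | c , c∈ , _ , w = c , c∈ , w

  att : V → V
  att v = proj₁ (attachment v)

  att∈B : ∀ v → att v ∈ B
  att∈B v = proj₁ (proj₂ (attachment v))

  att-walk : ∀ v → OutWalk v (att v)
  att-walk v = proj₂ (proj₂ (attachment v))

  att-fixes : ∀ {b} → b ∈ B → att b ≡ b
  att-fixes {b} b∈ = separated (att∈B b) b∈ (reverseᵒ (att-walk b))

  att≡⇔ : ∀ u v → att u ≡ att v ⇔ OutWalk u v
  att≡⇔ u v = mk⇔
    (λ eq → att-walk u ++ᵒ subst (λ t → OutWalk t v) (sym eq) (reverseᵒ (att-walk v)))
    (λ w → separated (att∈B u) (att∈B v) (reverseᵒ (att-walk u) ++ᵒ (w ++ᵒ att-walk v)))

  att∈ : ∀ {X} → ConnectedSet G X → (Σ V λ b → b ∈ X × b ∈ B) → ∀ {u} → u ∈ X → att u ∈ X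
  att∈ {X} cX (b , b∈X , b∈B) {u} u∈X with firstInB (fromWalkIn (cX u b u∈X b∈X)) b∈B
  ... | c , c∈B , c∈X , w =
    subst (_∈ X) (separated c∈B (att∈B u) (reverseᵒ w ++ᵒ att-walk u)) c∈X

  open Image att (λ x → att-fixes (att∈B x)) public using (M; π; π-surjective; π≡⇔r≡)

  π≡⇔ : ∀ u v → π u ≡ π v ⇔ OutWalk u v
  π≡⇔ u v = mk⇔ (to (att≡⇔ u v) ∘ to (π≡⇔r≡ u v)) (from (π≡⇔r≡ u v) ∘ from (att≡⇔ u v))

  π-outside : ∀ {u v} → Outside u v → π u ≡ π v
  π-outside e = from (π≡⇔ _ _) (step e done)

  ContractedAdj : Fin M → Fin M → Set
  ContractedAdj a b = a ≢ b × ∃₂ λ u v → π u ≡ a × π v ≡ b × Adj G u v × ¬ Outside u v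

  contracted : Graph
  contracted = record
    { n      = M
    ; Adj    = ContractedAdj
    ; adj?   = λ a b → ¬? (a ≟ b) ×-dec any? (λ u → any? (λ v →
                 (π u ≟ a) ×-dec ((π v ≟ b) ×-dec (adj? G u v ×-dec ¬? (outside? u v)))))
    ; sym    = λ (a≢b , u , v , πu , πv , e , ¬out) →
                 (a≢b ∘ sym) , v , u , πv , πu , Graph.sym G e , ¬out ∘ outside-sym
    ; irrefl = λ (a≢a , _) → a≢a refl
    }

  terminal? : ∀ a → Dec (∃ λ u → π u ≡ a × u ∈ Z)
  terminal? a = any? (λ u → (π u ≟ a) ×-dec (u ∈? Z))

  Z' : Subset M
  Z' = ⟦ terminal? ⟧

  isContraction : IsContraction G Z Outside contracted Z' π
  isContraction = record
    { surj  = π-surjective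
    ; merge = π≡⇔
    ; adj   = λ a b → mk⇔ (λ a~b → a~b) (λ a~b → a~b)
    ; term  = λ a → mk⇔ (∈⟦⟧⁻ terminal?) (∈⟦⟧⁺ terminal?)
    }

  pushMinor : ∀ {K} (m : ZMinor K G Z) → (∀ h → Σ V λ b → b ∈ ZMinor.branch m h × b ∈ B) →
              ZMinor K contracted Z'
  pushMinor {K} m meets = record
    { branch    = image
    ; disjoint  = λ h h' a a∈ a∈' →
        imagesDisjoint h h' a (∈⟦⟧⁻ (image? h) a∈) (∈⟦⟧⁻ (image? h') a∈')
    ; connected = λ h a b a∈ b∈ → imageConnected h (∈⟦⟧⁻ (image? h) a∈) (∈⟦⟧⁻ (image? h) b∈)
    ; terminal  = imageTerminal
    ; edges     = imageEdges
    }
    where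
    open ZMinor m

    image? : ∀ h a → Dec (∃ λ u → π u ≡ a × u ∈ branch h)
    image? h a = any? (λ u → (π u ≟ a) ×-dec (u ∈? branch h))

    image : Fin (n K) → Subset M
    image h = ⟦ image? h ⟧

    π∈image : ∀ {h u} → u ∈ branch h → π u ∈ image h
    π∈image u∈ = ∈⟦⟧⁺ (image? _) (_ , refl , u∈)

    -- vertices merged by the contraction lie in the same branch set, since
    -- each branch set contains the attachments of its vertices
    sameBranch : ∀ {h h' u u'} → u ∈ branch h → u' ∈ branch h' → π u ≡ π u' → h ≡ h'
    sameBranch {h} {h'} {u} {u'} u∈ u'∈ eq =
      disjoint h h' (att u) (att∈ (connected h) (meets h) u∈)
        (subst (_∈ branch h') (sym (to (π≡⇔r≡ u u') eq)) (att∈ (connected h') (meets h') u'∈))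

    imagesDisjoint : ∀ h h' a → (∃ λ u → π u ≡ a × u ∈ branch h) →
                     (∃ λ u → π u ≡ a × u ∈ branch h') → h ≡ h'
    imagesDisjoint h h' a (u , πu , u∈) (u' , πu' , u'∈) = sameBranch u∈ u'∈ (trans πu (sym πu'))

    mapWalk : ∀ {h u v} → WalkIn G (branch h) u v → WalkIn contracted (image h) (π u) (π v)
    mapWalk (here u∈) = here (π∈image u∈)
    mapWalk {h} (step {u} {w} u∈ e rest) with π u ≟ π w
    ... | yes πu≡πw = subst (λ t → WalkIn contracted (image h) t _) (sym πu≡πw) (mapWalk rest)
    ... | no πu≢πw  =
      step (π∈image u∈) (πu≢πw , u , w , refl , refl , e , πu≢πw ∘ π-outside) (mapWalk rest)

    imageConnected : ∀ h {a b} → (∃ λ u → π u ≡ a × u ∈ branch h) →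
                     (∃ λ u → π u ≡ b × u ∈ branch h) →
                     WalkIn contracted (image h) a b
    imageConnected h (u , refl , u∈) (v , refl , v∈) = mapWalk (connected h u v u∈ v∈)

    imageTerminal : ∀ h → ∃ λ z → z ∈ Z' × z ∈ image h
    imageTerminal h with terminal h
    ... | z , z∈Z , z∈ = π z , ∈⟦⟧⁺ terminal? (z , refl , z∈Z) , π∈image z∈

    imageEdges : ∀ h h' → Adj K h h' → ∃₂ λ a b → a ∈ image h × b ∈ image h' × ContractedAdj a b
    imageEdges h h' h~h' with edges h h' h~h'
    ... | u , v , u∈ , v∈ , e =
      π u , π v , π∈image u∈ , π∈image v∈ , (πu≢πv , u , v , refl , refl , e , πu≢πv ∘ π-outside)
      where
      πu≢πv : π u ≢ π v
      πu≢πv eq = irrefl K (subst (Adj K h) (sym (sameBranch u∈ v∈ eq)) h~h')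

liftMinor : ∀ {G Z F H Z' π K} → IsContraction G Z F H Z' π → (∀ {u v} → F u v → Adj G u v) →
            ZMinor K H Z' → ZMinor K G Z
liftMinor {G} {Z} {F} {H} {Z'} {π} {K} c F⊆E m = record
  { branch    = preimage
  ; disjoint  = λ h h' v v∈ v∈' →
      disjoint h h' (π v) (∈⟦⟧⁻ (preimage? h) v∈) (∈⟦⟧⁻ (preimage? h') v∈')
  ; connected = λ h u v u∈ v∈ →
      toWalkIn (λ a → a)
        (lift (connected h (π u) (π v) (∈⟦⟧⁻ (preimage? h) u∈) (∈⟦⟧⁻ (preimage? h) v∈)) refl refl)
  ; terminal  = preimageTerminal
  ; edges     = preimageEdges
  }
  where
  open Walks G
  open IsContraction c
  open ZMinor m

  preimage? : ∀ h u → Dec (π u ∈ branch h)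
  preimage? h u = π u ∈? branch h

  preimage : Fin (n K) → Subset (n G)
  preimage h = ⟦ preimage? h ⟧

  ∈preimage : ∀ {h a u} → a ∈ branch h → π u ≡ a → u ∈ preimage h
  ∈preimage {h} a∈ refl = ∈⟦⟧⁺ (preimage? h) a∈

  liftClass : ∀ {h u v} → FWalk G F u v → π u ∈ branch h → Walk (Adj G) (_∈ preimage h) u v
  liftClass done πu∈ = nil (∈preimage πu∈ refl)
  liftClass {h} (step {w = w} f rest) πu∈ =
    cons (∈preimage πu∈ refl) (F⊆E f)
      (liftClass rest (subst (_∈ branch h) (from (merge _ w) (step f done)) πu∈))

  lift : ∀ {h a b} → WalkIn H (branch h) a b →
         ∀ {u v} → π u ≡ a → π v ≡ b → Walk (Adj G) (_∈ preimage h) u v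
  lift {h} (here a∈) {u} {v} πu πv =
    liftClass (to (merge u v) (trans πu (sym πv))) (subst (_∈ branch h) (sym πu) a∈)
  lift {h} (step a∈ a~w rest) {u} {v} πu πv with to (adj _ _) a~w
  ... | _ , u' , w' , πu' , πw' , e , _ =
    liftClass (to (merge u u') (trans πu (sym πu'))) (subst (_∈ branch h) (sym πu) a∈)
      ++ʷ cons (∈preimage a∈ πu') e (lift rest πw' πv)

  preimageTerminal : ∀ h → ∃ λ z → z ∈ Z × z ∈ preimage h
  preimageTerminal h with terminal h
  ... | a , a∈Z' , a∈ with to (term a) a∈Z'
  ...   | u , πu , u∈Z = u , u∈Z , ∈preimage a∈ πu

  preimageEdges : ∀ h h' → Adj K h h' → ∃₂ λ u v → u ∈ preimage h × v ∈ preimage h' × Adj G u v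
  preimageEdges h h' h~h' with edges h h' h~h'
  ... | a , b , a∈ , b∈ , a~b with to (adj a b) a~b
  ...   | _ , u , v , πu , πv , e , _ = u , v , ∈preimage a∈ πu , ∈preimage b∈ πv , e

-- A simple path can be threaded through four distinct branch sets
-- X i, X j, X k, X l of a Z-minor whose indices are consecutively adjacent
-- in K: from any vertex of X i to any vertex of X l, visiting X j and X k.
module Chains {K G : Graph} {Z : Subset (n G)} (m : ZMinor K G Z) where
  open Walks G
  open ZMinor m

  segment : ∀ h {p q} → p ∈ branch h → q ∈ branch h → SimplePath (Adj G) (_∈ branch h) p q
  segment h p∈ q∈ = shortcut (fromWalkIn (connected h _ _ p∈ q∈))

  distinctBranches : ∀ {i j} {vs ws : List V} → i ≢ j →
                     All (_∈ branch i) vs → All (_∈ branch j) ws → Disjoint vs ws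
  distinctBranches i≢j in-i in-j (v∈vs , v∈ws) =
    i≢j (disjoint _ _ _ (All.lookup in-i v∈vs) (All.lookup in-j v∈ws))

  disjoint-++ : ∀ {vs ws ws' : List V} → Disjoint vs ws → Disjoint vs ws' → Disjoint vs (ws ++ ws')
  disjoint-++ {ws = ws} d d' (v∈vs , v∈) =
    [ (λ v∈ws → d (v∈vs , v∈ws)) , (λ v∈ws' → d' (v∈vs , v∈ws')) ]′ (∈-++⁻ ws v∈)

  ChainPath : Fin (n K) → Fin (n K) → V → V → Set
  ChainPath j k p q = Σ (List V) λ vs → Path (Adj G) p q vs × Unique vs ×
                        (∃ λ c → c ∈ branch j × c ∈ˡ vs) × (∃ λ d → d ∈ branch k × d ∈ˡ vs)

  chainPath : ∀ {i j k l p q} → Adj K i j → Adj K j k → Adj K k l →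
              i ≢ j → i ≢ k → i ≢ l → j ≢ k → j ≢ l → k ≢ l →
              p ∈ branch i → q ∈ branch l → ChainPath j k p q
  chainPath {i} {j} {k} {l} i~j j~k k~l i≢j i≢k i≢l j≢k j≢l k≢l p∈ q∈
    with edges i j i~j | edges j k j~k | edges k l k~l
  ... | a , b , a∈ , b∈ , a~b | c , d , c∈ , d∈ , c~d | e , f , e∈ , f∈ , e~f
    with segment i p∈ a∈ | segment j b∈ c∈ | segment k d∈ e∈ | segment l f∈ q∈
  ... | vsᵢ , pᵢ , uᵢ , inᵢ | vsⱼ , pⱼ , uⱼ , inⱼ | vsₖ , pₖ , uₖ , inₖ | vsₗ , pₗ , uₗ , inₗ =
    vsᵢ ++ (vsⱼ ++ (vsₖ ++ vsₗ)) , join pᵢ a~b (join pⱼ c~d (join pₖ e~f pₗ)) , uniq ,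
    (c , c∈ , ∈-++⁺ʳ vsᵢ (∈-++⁺ˡ (pathLast pⱼ))) ,
    (d , d∈ , ∈-++⁺ʳ vsᵢ (∈-++⁺ʳ vsⱼ (∈-++⁺ˡ (pathFirst pₖ))))
    where
    uniq : Unique (vsᵢ ++ (vsⱼ ++ (vsₖ ++ vsₗ)))
    uniq = Unique.++⁺ uᵢ
             (Unique.++⁺ uⱼ
               (Unique.++⁺ uₖ uₗ (distinctBranches k≢l inₖ inₗ))
               (disjoint-++ (distinctBranches j≢k inⱼ inₖ) (distinctBranches j≢l inⱼ inₗ)))
             (disjoint-++ (distinctBranches i≢j inᵢ inⱼ)
               (disjoint-++ (distinctBranches i≢k inᵢ inₖ) (distinctBranches i≢l inᵢ inₗ)))

-- All five branch sets of a terminal K₂,₃ minor meet a common block: a block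
-- B through an edge between X₀ and X₂ contains the chain paths 0–3–1–2 and
-- 0–4–1–2 between the ends of that edge, which meet X₁, X₃ and X₄.
k23InBlock : ∀ {G Z} (m : ZMinor K23 G Z) →
             ¬ ¬ (Σ (Subset (n G)) λ B → IsBlock G B × ∀ h → ∃ λ b → b ∈ ZMinor.branch m h × b ∈ B)
k23InBlock {G} m noBlock with ZMinor.edges m zero (suc (suc zero)) (λ ())
... | u₀ , u₂ , u₀∈ , u₂∈ , e =
  blockThroughEdge e λ (B , isB , u₀∈B , u₂∈B) → noBlock (B , isB , meets isB u₀∈B u₂∈B)
  where
  open Blocks G
  open Chains m
  open ZMinor m

  meets : ∀ {B} → IsBlock G B → u₀ ∈ B → u₂ ∈ B → ∀ h → ∃ λ b → b ∈ branch h × b ∈ B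
  meets {B} isB u₀∈B u₂∈B = λ where
      zero                         → u₀ , u₀∈ , u₀∈B
      (suc zero)                   → proj₂ (inBlock via3)
      (suc (suc zero))             → u₂ , u₂∈ , u₂∈B
      (suc (suc (suc zero)))       → proj₁ (inBlock via3)
      (suc (suc (suc (suc zero)))) → proj₁ (inBlock via4)
    where
    inBlock : ∀ {j k} → ChainPath j k u₀ u₂ →
              (∃ λ c → c ∈ branch j × c ∈ B) × (∃ λ d → d ∈ branch k × d ∈ B)
    inBlock (vs , path , uniq , (c , c∈ , c∈vs) , (d , d∈ , d∈vs)) =
      (c , c∈ , inB c∈vs) , (d , d∈ , inB d∈vs)
      where
      inB : ∀ {u} → u ∈ˡ vs → u ∈ B
      inB = pathInBlock isB path uniq u₀∈B u₂∈B
    via3 : ChainPath (suc (suc (suc zero))) (suc zero) u₀ u₂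
    via3 = chainPath (λ ()) (λ ()) (λ ()) (λ ()) (λ ()) (λ ()) (λ ()) (λ ()) (λ ()) u₀∈ u₂∈
    via4 : ChainPath (suc (suc (suc (suc zero)))) (suc zero) u₀ u₂
    via4 = chainPath (λ ()) (λ ()) (λ ()) (λ ()) (λ ()) (λ ()) (λ ()) (λ ()) (λ ()) u₀∈ u₂∈

corollary1 : (G : Graph) (Z : Subset (n G)) → Connected G →
    (¬ HasTerminalK23 G Z) ⇔
    (∀ (B : Subset (n G)) → IsBlock G B →
       ∀ (H : Graph) (Z' : Subset (n H)) (π : Fin (n G) → Fin (n H)) →
       IsContraction G Z (EdgeNotIn G B) H Z' π →
       ¬ HasTerminalK23 H Z')
corollary1 G Z connG = mk⇔ restrict extend
  where
  restrict : ¬ HasTerminalK23 G Z → ∀ B → IsBlock G B → ∀ H Z' π →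
             IsContraction G Z (EdgeNotIn G B) H Z' π → ¬ HasTerminalK23 H Z'
  restrict noMinor B _ H Z' π c m = noMinor (liftMinor c proj₁ m)

  extend : (∀ B → IsBlock G B → ∀ H Z' π →
             IsContraction G Z (EdgeNotIn G B) H Z' π → ¬ HasTerminalK23 H Z') →
           ¬ HasTerminalK23 G Z
  extend noBlockMinor m = k23InBlock m λ (B , isB , meets) →
    let open BlockContraction G Z isB connG
    in noBlockMinor B isB contracted Z' π isContraction (pushMinor m meets)
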